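{- For any positive integers $n$ and $t$, write $t=(n+1)q+r$ with $q=\lfloor t/(n+1)\rfloor$ and $0\le r\le n$. Then \[\pi_t^*(K_n)=\begin{cases}2t-2q=2nq+2r & \text{if } r<n,\\ 2t-2q-1=2nq+2n-1 & \text{if } r=n.\end{cases}\] In particular, $\pi_t^*(K_n)=2t$ if and only if $t<n$.
   Context: A distribution on a graph $G=(V,E)$ is a function $D:V\to\mathbb{N}$, with size $|D|=\sum_v D(v)$. A pebbling move removes two pebbles from a vertex having at least two pebbles and places one pebble on a neighbor. A distribution $D$ is $t$-solvable if for every vertex $v$, some sequence of pebbling moves starting from $D$ results in a distribution with at least $t$ pebbles on $v$. The optimal $t$-pebbling number $\pi_t^*(G)$ is the minimum size of a $t$-solvable distribution on $G$. $K_n$ is the complete graph on $n$ vertices. -}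

module Defs where

open import Data.Nat using (ℕ; zero; suc; _+_; _*_; _∸_; _≤_; _<_)
open import Data.Fin using (Fin)
open import Data.List using (List; map; allFin)
open import Data.Nat.ListAction using (sum)
open import Data.Product using (Σ; ∃; _×_; _,_)
open import Relation.Binary.PropositionalEquality using (_≡_; _≢_)
open import Relation.Binary.Construct.Closure.ReflexiveTransitive using (Star)

Adj : ∀ {n} → Fin n → Fin n → Set
Adj u v = u ≢ v

Distribution : ℕ → Set
Distribution n = Fin n → ℕ

size : ∀ {n} → Distribution n → ℕ
size {n} D = sum (map D (allFin n))

Move : ∀ {n} → Distribution n → Distribution n → Set
Move {n} D D' = Σ (Fin n) λ u → Σ (Fin n) λ v →
  Adj u v × 2 ≤ D u × D' u + 2 ≡ D u × D' v ≡ suc (D v) ×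
  (∀ w → w ≢ u → w ≢ v → D' w ≡ D w)

Reachable : ∀ {n} → Distribution n → Distribution n → Set
Reachable = Star Move

Solvable : ∀ {n} → ℕ → Distribution n → Set
Solvable {n} t D = ∀ (v : Fin n) → ∃ λ D' → Reachable D D' × t ≤ D' v

IsOptPebblingKn : ℕ → ℕ → ℕ → Set
IsOptPebblingKn n t m =
  (∃ λ (D : Distribution n) → Solvable t D × size D ≡ m) ×
  (∀ (D : Distribution n) → Solvable t D → m ≤ size D)

-- On K_n every vertex is adjacent to every other, so the most pebbles that D can deliver
-- to v is its capacity ⌈D(v)/2⌉ + Σ_u ⌊D(u)/2⌋: no move increases it, and greedily moving
-- pairs onto v attains it. Hence D is t-solvable iff every capacity is at least t. Summing
-- over v gives n·t ≤ Σ⌈D/2⌉ + n·Σ⌊D/2⌋, and with Σ⌊D/2⌋ ≤ Σ⌈D/2⌉ this forces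
-- |D| ≥ 2t − 2q, minus one when r = n. Distributions that are constant off a single vertex
-- attain these bounds.
module Submission where

open import Defs
open import Data.Nat using (ℕ; suc; _+_; _*_; _∸_; _≤_; _<_)
open import Data.Nat.DivMod using (_/_; _%_)
open import Data.Product using (_×_)
open import Relation.Binary.PropositionalEquality using (_≡_)
open import Function.Bundles using (_⇔_)

open import Data.Nat.Properties hiding (suc-injective; _≟_)
open import Algebra.Properties.CommutativeMonoid.Sum +-0-commutativeMonoid
  using (sum; ∑-distrib-+; sum-cong-≗; sum-replicate-zero)
open import Data.Fin using (Fin; zero; suc)
open import Data.Fin.Properties using (_≟_; any?; suc-injective)
open import Data.List using (tabulate)
open import Data.List.Properties using (map-tabulate)
import Data.Nat.ListAction as List
open import Data.Nat using (zero; ⌊_/2⌋; ⌈_/2⌉; z≤n; s≤s; _≤?_; NonZero)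
open import Data.Nat.DivMod using (m≡m%n+[m/n]*n; m%n<n; m<n⇒m%n≡m; m<n⇒m/n≡0)
open import Data.Nat.Tactic.RingSolver using (solve-∀)
open import Data.Product using (∃; _,_)
open import Data.Sum using (inj₁; inj₂)
open import Data.Vec.Functional using (updateAt)
open import Data.Vec.Functional.Properties using (updateAt-updates; updateAt-minimal)
open import Function using (_∘_; id; const)
open import Function.Bundles using (mk⇔; Equivalence)
open import Data.Nat.Induction using (<-wellFounded)
open import Induction.WellFounded using (Acc; acc)
open import Relation.Binary.Construct.Closure.ReflexiveTransitive using (ε; _◅_)
open import Relation.Nullary using (yes; no; contradiction)
open import Relation.Nullary.Decidable using (_×-dec_; ¬?)
open import Relation.Binary.PropositionalEquality
  using (refl; sym; trans; cong; cong₂; subst; _≢_; ≢-sym; module ≡-Reasoning)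

sum-tabulate : ∀ {n} (f : Fin n → ℕ) → List.sum (tabulate f) ≡ sum f
sum-tabulate {zero}  f = refl
sum-tabulate {suc n} f = cong (f zero +_) (sum-tabulate (f ∘ suc))

size≡sum : ∀ {n} (D : Distribution n) → size D ≡ sum D
size≡sum D = trans (cong List.sum (map-tabulate id D)) (sum-tabulate D)

sum-const : ∀ n c → sum {n} (const c) ≡ n * c
sum-const zero    c = refl
sum-const (suc n) c = cong (c +_) (sum-const n c)

sum-mono-≤ : ∀ {n} {f g : Fin n → ℕ} → (∀ i → f i ≤ g i) → sum f ≤ sum g
sum-mono-≤ {zero}  f≤g = z≤n
sum-mono-≤ {suc n} f≤g = +-mono-≤ (f≤g zero) (sum-mono-≤ (f≤g ∘ suc))

term≤sum : ∀ {n} (f : Fin n → ℕ) i → f i ≤ sum f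
term≤sum f zero    = m≤m+n (f zero) _
term≤sum f (suc i) = ≤-trans (term≤sum (f ∘ suc) i) (m≤n+m _ (f zero))

sum-differ-at : ∀ {n} {f g : Fin n → ℕ} u → (∀ x → x ≢ u → f x ≡ g x) →
                sum f + g u ≡ sum g + f u
sum-differ-at {suc n} {f} {g} zero f≗g = begin
  f zero + sum (f ∘ suc) + g zero  ≡⟨ cong (λ s → f zero + s + g zero) (sum-cong-≗ (λ i → f≗g (suc i) λ ())) ⟩
  f zero + sum (g ∘ suc) + g zero  ≡⟨ swap-ends (f zero) (sum (g ∘ suc)) (g zero) ⟩
  g zero + sum (g ∘ suc) + f zero  ∎
  where
  open ≡-Reasoning
  swap-ends : ∀ a s b → a + s + b ≡ b + s + a
  swap-ends = solve-∀
sum-differ-at {suc n} {f} {g} (suc u) f≗g = begin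
  f zero + sum (f ∘ suc) + g (suc u)    ≡⟨ +-assoc (f zero) _ _ ⟩
  f zero + (sum (f ∘ suc) + g (suc u))  ≡⟨ cong₂ _+_ (f≗g zero λ ()) (sum-differ-at u (λ x x≢u → f≗g (suc x) (x≢u ∘ suc-injective))) ⟩
  g zero + (sum (g ∘ suc) + f (suc u))  ≡⟨ +-assoc (g zero) _ _ ⟨
  g zero + sum (g ∘ suc) + f (suc u)    ∎
  where open ≡-Reasoning

sum-differ-at₂ : ∀ {n} {f g : Fin n → ℕ} {u w} → u ≢ w →
                 (∀ x → x ≢ u → x ≢ w → f x ≡ g x) →
                 sum f + (g u + g w) ≡ sum g + (f u + f w)
sum-differ-at₂ {f = f} {g} {u} {w} u≢w f≗g = begin
  sum f + (g u + g w)  ≡⟨ +-assoc (sum f) (g u) (g w) ⟨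
  sum f + g u + g w    ≡⟨ cong (λ x → sum f + x + g w) (updateAt-updates u f) ⟨
  sum f + h u + g w    ≡⟨ cong (_+ g w) (sum-differ-at u (λ x x≢u → sym (updateAt-minimal x u f x≢u))) ⟩
  sum h + f u + g w    ≡⟨ swap-last (sum h) (f u) (g w) ⟩
  sum h + g w + f u    ≡⟨ cong (_+ f u) (sum-differ-at w h≗g) ⟩
  sum g + h w + f u    ≡⟨ cong (λ x → sum g + x + f u) (updateAt-minimal w u f (≢-sym u≢w)) ⟩
  sum g + f w + f u    ≡⟨ swap-last (sum g) (f w) (f u) ⟩
  sum g + f u + f w    ≡⟨ +-assoc (sum g) (f u) (f w) ⟩
  sum g + (f u + f w)  ∎
  where
  open ≡-Reasoning
  h : Fin _ → ℕ
  h = updateAt f u (const (g u))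
  h≗g : ∀ x → x ≢ w → h x ≡ g x
  h≗g x x≢w with x ≟ u
  ... | yes refl = updateAt-updates u f
  ... | no x≢u   = trans (updateAt-minimal x u f x≢u) (f≗g x x≢u x≢w)
  swap-last : ∀ a b c → a + b + c ≡ a + c + b
  swap-last = solve-∀

floorHalves : ∀ {n} → Distribution n → ℕ
floorHalves D = sum (λ u → ⌊ D u /2⌋)

ceilHalves : ∀ {n} → Distribution n → ℕ
ceilHalves D = sum (λ u → ⌈ D u /2⌉)

capacity : ∀ {n} → Fin n → Distribution n → ℕ
capacity v D = ⌈ D v /2⌉ + floorHalves D

⌈n/2⌉≤1+⌊n/2⌋ : ∀ n → ⌈ n /2⌉ ≤ suc ⌊ n /2⌋
⌈n/2⌉≤1+⌊n/2⌋ zero          = z≤n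
⌈n/2⌉≤1+⌊n/2⌋ (suc zero)    = s≤s z≤n
⌈n/2⌉≤1+⌊n/2⌋ (suc (suc n)) = s≤s (⌈n/2⌉≤1+⌊n/2⌋ n)

⌊n/2⌋≡0 : ∀ {n} → n < 2 → ⌊ n /2⌋ ≡ 0
⌊n/2⌋≡0 (s≤s z≤n)       = refl
⌊n/2⌋≡0 (s≤s (s≤s z≤n)) = refl

≤-capacity : ∀ {n} (D : Distribution n) v → D v ≤ capacity v D
≤-capacity D v = begin
  D v                         ≡⟨ ⌊n/2⌋+⌈n/2⌉≡n (D v) ⟨
  ⌊ D v /2⌋ + ⌈ D v /2⌉        ≡⟨ +-comm ⌊ D v /2⌋ ⌈ D v /2⌉ ⟩
  ⌈ D v /2⌉ + ⌊ D v /2⌋        ≤⟨ +-monoʳ-≤ ⌈ D v /2⌉ (term≤sum (λ u → ⌊ D u /2⌋) v) ⟩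
  capacity v D                ∎
  where open ≤-Reasoning

module _ {n} {D D′ : Distribution n} {u w : Fin n} (u≢w : u ≢ w)
         (D′u : D′ u + 2 ≡ D u) (D′w : D′ w ≡ suc (D w))
         (D′≗D : ∀ x → x ≢ u → x ≢ w → D′ x ≡ D x) where

  sum-step : sum D′ < sum D
  sum-step = ≤-reflexive (+-cancelʳ-≡ (D′ u + suc (D w)) _ _ (begin
    suc (sum D′) + (D′ u + suc (D w))  ≡⟨ shuffle (sum D′) (D′ u) (D w) ⟩
    sum D′ + ((D′ u + 2) + D w)        ≡⟨ cong (λ x → sum D′ + (x + D w)) D′u ⟩
    sum D′ + (D u + D w)               ≡⟨ sum-differ-at₂ u≢w D′≗D ⟩
    sum D + (D′ u + D′ w)              ≡⟨ cong (λ x → sum D + (D′ u + x)) D′w ⟩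
    sum D + (D′ u + suc (D w))         ∎))
    where
    open ≡-Reasoning
    shuffle : ∀ s a b → suc s + (a + suc b) ≡ s + ((a + 2) + b)
    shuffle = solve-∀

  floorHalves-step : floorHalves D′ + suc ⌊ D w /2⌋ ≡ floorHalves D + ⌈ D w /2⌉
  floorHalves-step = +-cancelˡ-≡ a _ _ (begin
    a + (F′ + suc ⌊ D w /2⌋)           ≡⟨ shuffle a F′ ⌊ D w /2⌋ ⟩
    F′ + (suc a + ⌊ D w /2⌋)           ≡⟨ cong (λ x → F′ + (x + ⌊ D w /2⌋)) ⌊Du/2⌋ ⟨
    F′ + (⌊ D u /2⌋ + ⌊ D w /2⌋)       ≡⟨ sum-differ-at₂ u≢w (λ x x≢u x≢w → cong ⌊_/2⌋ (D′≗D x x≢u x≢w)) ⟩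
    F + (a + ⌊ D′ w /2⌋)               ≡⟨ cong (λ x → F + (a + ⌊ x /2⌋)) D′w ⟩
    F + (a + ⌈ D w /2⌉)                ≡⟨ x+[y+z]≡y+[x+z] F a ⌈ D w /2⌉ ⟩
    a + (F + ⌈ D w /2⌉)                ∎)
    where
    open ≡-Reasoning
    F = floorHalves D
    F′ = floorHalves D′
    a = ⌊ D′ u /2⌋
    ⌊Du/2⌋ : ⌊ D u /2⌋ ≡ suc a
    ⌊Du/2⌋ = trans (cong ⌊_/2⌋ (sym D′u)) (cong ⌊_/2⌋ (+-comm (D′ u) 2))
    shuffle : ∀ a f b → a + (f + suc b) ≡ f + (suc a + b)
    shuffle = solve-∀
    x+[y+z]≡y+[x+z] : ∀ x y z → x + (y + z) ≡ y + (x + z)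
    x+[y+z]≡y+[x+z] = solve-∀

  floorHalves-step-≤ : floorHalves D′ ≤ floorHalves D
  floorHalves-step-≤ = +-cancelʳ-≤ (suc ⌊ D w /2⌋) _ _ (begin
    floorHalves D′ + suc ⌊ D w /2⌋  ≡⟨ floorHalves-step ⟩
    floorHalves D + ⌈ D w /2⌉       ≤⟨ +-monoʳ-≤ (floorHalves D) (⌈n/2⌉≤1+⌊n/2⌋ (D w)) ⟩
    floorHalves D + suc ⌊ D w /2⌋   ∎)
    where open ≤-Reasoning

  capacity-target : capacity w D′ ≡ capacity w D
  capacity-target = begin
    ⌈ D′ w /2⌉ + floorHalves D′      ≡⟨ cong (λ x → ⌈ x /2⌉ + floorHalves D′) D′w ⟩
    suc ⌊ D w /2⌋ + floorHalves D′   ≡⟨ +-comm (suc ⌊ D w /2⌋) _ ⟩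
    floorHalves D′ + suc ⌊ D w /2⌋   ≡⟨ floorHalves-step ⟩
    floorHalves D + ⌈ D w /2⌉        ≡⟨ +-comm (floorHalves D) _ ⟩
    ⌈ D w /2⌉ + floorHalves D        ∎
    where open ≡-Reasoning

capacity-move : ∀ {n} {D D′ : Distribution n} → Move D D′ → ∀ v → capacity v D′ ≤ capacity v D
capacity-move {D = D} {D′} (u , w , u≢w , _ , D′u , D′w , D′≗D) v with v ≟ w
... | yes refl = ≤-reflexive (capacity-target u≢w D′u D′w D′≗D)
... | no v≢w   = +-mono-≤ (⌈n/2⌉-mono D′v≤Dv) (floorHalves-step-≤ u≢w D′u D′w D′≗D)
  where
  D′v≤Dv : D′ v ≤ D v
  D′v≤Dv with v ≟ u
  ... | yes refl = ≤-trans (m≤m+n (D′ v) 2) (≤-reflexive D′u)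
  ... | no v≢u   = ≤-reflexive (D′≗D v v≢u v≢w)

capacity-reachable : ∀ {n} {D D′ : Distribution n} → Reachable D D′ → ∀ v → capacity v D′ ≤ capacity v D
capacity-reachable ε          v = ≤-refl
capacity-reachable (m ◅ D→D′) v = ≤-trans (capacity-reachable D→D′ v) (capacity-move m v)

fire : ∀ {n} → Fin n → Fin n → Distribution n → Distribution n
fire u v D = updateAt (updateAt D u (_∸ 2)) v suc

module _ {n} {u v : Fin n} {D : Distribution n} (u≢v : u ≢ v) (2≤Du : 2 ≤ D u) where

  fire-source : fire u v D u + 2 ≡ D u
  fire-source = trans (cong (_+ 2) (trans (updateAt-minimal u v _ u≢v) (updateAt-updates u D))) (m∸n+n≡m 2≤Du)

  fire-target : fire u v D v ≡ suc (D v)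
  fire-target = trans (updateAt-updates v _) (cong suc (updateAt-minimal v u D (≢-sym u≢v)))

  fire-others : ∀ x → x ≢ u → x ≢ v → fire u v D x ≡ D x
  fire-others x x≢u x≢v = trans (updateAt-minimal x v _ x≢v) (updateAt-minimal x u D x≢u)

  fire-move : Move D (fire u v D)
  fire-move = u , v , u≢v , 2≤Du , fire-source , fire-target , fire-others

  fire-sum-< : sum (fire u v D) < sum D
  fire-sum-< = sum-step u≢v fire-source fire-target fire-others

  fire-capacity : capacity v (fire u v D) ≡ capacity v D
  fire-capacity = capacity-target u≢v fire-source fire-target fire-others

capacity-stuck : ∀ {n} (D : Distribution n) v → (∀ u → u ≢ v → D u < 2) → capacity v D ≡ D v
capacity-stuck {n} D v small = begin
  ⌈ D v /2⌉ + floorHalves D     ≡⟨ cong (⌈ D v /2⌉ +_) floorHalves≡ ⟩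
  ⌈ D v /2⌉ + ⌊ D v /2⌋          ≡⟨ +-comm ⌈ D v /2⌉ _ ⟩
  ⌊ D v /2⌋ + ⌈ D v /2⌉          ≡⟨ ⌊n/2⌋+⌈n/2⌉≡n (D v) ⟩
  D v                           ∎
  where
  open ≡-Reasoning
  floorHalves≡ : floorHalves D ≡ ⌊ D v /2⌋
  floorHalves≡ = trans (sym (+-identityʳ _))
    (trans (sum-differ-at v (λ u u≢v → ⌊n/2⌋≡0 (small u u≢v)))
           (cong (_+ ⌊ D v /2⌋) (sum-replicate-zero n)))

gather : ∀ {n} (D : Distribution n) v → ∃ λ D′ → Reachable D D′ × capacity v D ≤ D′ v
gather D v = go D (<-wellFounded (sum D))
  where
  go : ∀ D → Acc _<_ (sum D) → ∃ λ D′ → Reachable D D′ × capacity v D ≤ D′ v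
  go D (acc rec) with any? (λ u → ¬? (u ≟ v) ×-dec (2 ≤? D u))
  ... | no stuck = D , ε , ≤-reflexive (capacity-stuck D v λ u u≢v → ≰⇒> λ 2≤Du → stuck (u , u≢v , 2≤Du))
  ... | yes (u , u≢v , 2≤Du) with go (fire u v D) (rec (fire-sum-< u≢v 2≤Du))
  ...   | D′ , fire→D′ , cap≤D′v =
    D′ , fire-move u≢v 2≤Du ◅ fire→D′ , subst (_≤ D′ v) (fire-capacity u≢v 2≤Du) cap≤D′v

solvable⇔capacity : ∀ {n} t (D : Distribution n) → Solvable t D ⇔ (∀ v → t ≤ capacity v D)
solvable⇔capacity t D = mk⇔ necessary sufficient
  where
  necessary : Solvable t D → ∀ v → t ≤ capacity v D
  necessary solvable v with solvable v
  ... | D′ , D→D′ , t≤D′v = ≤-trans t≤D′v (≤-trans (≤-capacity D′ v) (capacity-reachable D→D′ v))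
  sufficient : (∀ v → t ≤ capacity v D) → Solvable t D
  sufficient t≤cap v with gather D v
  ... | D′ , D→D′ , cap≤D′v = D′ , D→D′ , ≤-trans (t≤cap v) cap≤D′v

size≡floorHalves+ceilHalves : ∀ {n} (D : Distribution n) → size D ≡ floorHalves D + ceilHalves D
size≡floorHalves+ceilHalves D = begin
  size D                               ≡⟨ size≡sum D ⟩
  sum D                                ≡⟨ sum-cong-≗ (λ u → ⌊n/2⌋+⌈n/2⌉≡n (D u)) ⟨
  sum (λ u → ⌊ D u /2⌋ + ⌈ D u /2⌉)    ≡⟨ ∑-distrib-+ (λ u → ⌊ D u /2⌋) (λ u → ⌈ D u /2⌉) ⟩
  floorHalves D + ceilHalves D         ∎
  where open ≡-Reasoning

floorHalves≤ceilHalves : ∀ {n} (D : Distribution n) → floorHalves D ≤ ceilHalves D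
floorHalves≤ceilHalves D = sum-mono-≤ (λ u → ⌊n/2⌋≤⌈n/2⌉ (D u))

solvable⇒n*t≤Σcapacity : ∀ {n} t (D : Distribution n) → Solvable t D →
                         n * t ≤ ceilHalves D + n * floorHalves D
solvable⇒n*t≤Σcapacity {n} t D solvable = begin
  n * t                                       ≡⟨ sum-const n t ⟨
  sum {n} (const t)                           ≤⟨ sum-mono-≤ (Equivalence.to (solvable⇔capacity t D) solvable) ⟩
  sum (λ v → capacity v D)                    ≡⟨ ∑-distrib-+ (λ v → ⌈ D v /2⌉) (const (floorHalves D)) ⟩
  ceilHalves D + sum {n} (const (floorHalves D)) ≡⟨ cong (ceilHalves D +_) (sum-const n (floorHalves D)) ⟩
  ceilHalves D + n * floorHalves D            ∎
  where open ≤-Reasoning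

2t∸2q≡2k : ∀ n q r → 2 * (r + q * suc n) ∸ 2 * q ≡ (n * q + r) + (n * q + r)
2t∸2q≡2k n q r = trans (cong (_∸ 2 * q) (split n q r)) (m+n∸n≡m _ (2 * q))
  where
  split : ∀ n q r → 2 * (r + q * suc n) ≡ (n * q + r) + (n * q + r) + 2 * q
  split = solve-∀

-- a and c stand for floorHalves and ceilHalves; as r ≤ n, the correction suc r ∸ n is
-- 1 when r = n and 0 otherwise.
size-bound : ∀ n .{{_ : NonZero n}} q r {a c} → a ≤ c → n * (r + q * suc n) ≤ c + n * a →
             2 * (r + q * suc n) ∸ 2 * q ∸ (suc r ∸ n) ≤ a + c
size-bound n q r {a} {c} a≤c n*t≤ =
  subst (λ y → y ∸ (suc r ∸ n) ≤ a + c) (sym (2t∸2q≡2k n q r)) (m≤n+o⇒m∸n≤o (k + k) x k+k≤)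
  where
  k = n * q + r
  x = suc r ∸ n
  k+k≤ : k + k ≤ x + (a + c)
  k+k≤ with k ≤? a
  ... | yes k≤a = ≤-trans (+-mono-≤ k≤a (≤-trans k≤a a≤c)) (m≤n+m (a + c) x)
  ... | no k≰a with d , 1+a+d≡k ← m≤n⇒∃[o]m+o≡n (≰⇒> k≰a) = begin
    k + k                               ≡⟨ cong (k +_) 1+a+d≡k ⟨
    k + (suc a + d)                     ≡⟨ regroup n q r a d ⟩
    a + (suc r + (d + n * q))           ≤⟨ +-monoʳ-≤ a (+-mono-≤ (m≤n+m∸n (suc r) n) (+-monoˡ-≤ (n * q) (m≤n*m d n))) ⟩
    a + ((n + x) + (n * d + n * q))     ≡⟨ regroup′ a n x (n * d) (n * q) ⟩
    x + (a + (n + n * d + n * q))       ≤⟨ +-monoʳ-≤ x (+-monoʳ-≤ a c-bound) ⟩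
    x + (a + c)                         ∎
    where
    open ≤-Reasoning
    regroup : ∀ n q r a d → (n * q + r) + (suc a + d) ≡ a + (suc r + (d + n * q))
    regroup = solve-∀
    regroup′ : ∀ a n x nd nq → a + ((n + x) + (nd + nq)) ≡ x + (a + (n + nd + nq))
    regroup′ = solve-∀
    c-bound : n + n * d + n * q ≤ c
    c-bound = +-cancelˡ-≤ (n * a) _ _ (begin
      n * a + (n + n * d + n * q)  ≡⟨ distrib n a d q ⟩
      n * (suc a + d + q)          ≡⟨ cong (λ y → n * (y + q)) 1+a+d≡k ⟩
      n * (k + q)                  ≡⟨ cong (n *_) (k+q≡t n q r) ⟩
      n * (r + q * suc n)          ≤⟨ n*t≤ ⟩
      c + n * a                    ≡⟨ +-comm c (n * a) ⟩
      n * a + c                    ∎)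
      where
      distrib : ∀ n a d q → n * a + (n + n * d + n * q) ≡ n * (suc a + d + q)
      distrib = solve-∀
      k+q≡t : ∀ n q r → n * q + r + q ≡ r + q * suc n
      k+q≡t = solve-∀

solvable⇒size≥ : ∀ {n} .{{_ : NonZero n}} q r (D : Distribution n) → Solvable (r + q * suc n) D →
                 2 * (r + q * suc n) ∸ 2 * q ∸ (suc r ∸ n) ≤ size D
solvable⇒size≥ {n} q r D solvable =
  subst (_ ≤_) (sym (size≡floorHalves+ceilHalves D))
    (size-bound n q r (floorHalves≤ceilHalves D) (solvable⇒n*t≤Σcapacity _ D solvable))

spike : ∀ {m} → ℕ → ℕ → Distribution (suc m)
spike a b zero    = a
spike a b (suc _) = b

size-spike : ∀ {m} a b → size (spike {m} a b) ≡ a + m * b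
size-spike {m} a b = trans (size≡sum (spike {m} a b)) (cong (a +_) (sum-const m b))

spike-solvable : ∀ {m t} a b →
                 t ≤ ⌈ a /2⌉ + (⌊ a /2⌋ + m * ⌊ b /2⌋) → t ≤ ⌈ b /2⌉ + (⌊ a /2⌋ + m * ⌊ b /2⌋) →
                 Solvable t (spike {m} a b)
spike-solvable {m} {t} a b t≤cap₀ t≤cap₁ = Equivalence.from (solvable⇔capacity t (spike a b)) λ where
    zero    → subst (λ F → t ≤ ⌈ a /2⌉ + F) (sym floorHalves-spike) t≤cap₀
    (suc _) → subst (λ F → t ≤ ⌈ b /2⌉ + F) (sym floorHalves-spike) t≤cap₁
  where
  floorHalves-spike : floorHalves (spike {m} a b) ≡ ⌊ a /2⌋ + m * ⌊ b /2⌋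
  floorHalves-spike = cong (⌊ a /2⌋ +_) (sum-const m ⌊ b /2⌋)

optimal-below : ∀ {n t q r} .{{_ : NonZero n}} → t ≡ r + q * suc n → r < n →
                IsOptPebblingKn n t (2 * t ∸ 2 * q)
optimal-below {suc m} {q = q} {r} refl r<n = (D , solvable , size-D) , lower
  where
  open ≤-Reasoning
  t = r + q * suc (suc m)
  D = spike {m} ((q + r) + (q + r)) (q + q)
  F≡ : ⌊ (q + r) + (q + r) /2⌋ + m * ⌊ q + q /2⌋ ≡ (q + r) + m * q
  F≡ = cong₂ (λ x y → x + m * y) (sym (n≡⌊n+n/2⌋ (q + r))) (sym (n≡⌊n+n/2⌋ q))
  t≡ : ∀ m q r → r + q * suc (suc m) ≡ q + ((q + r) + m * q)
  t≡ = solve-∀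
  solvable : Solvable t D
  solvable = spike-solvable _ _
    (begin
      t                                             ≡⟨ t≡ m q r ⟩
      q + ((q + r) + m * q)                         ≤⟨ +-monoˡ-≤ _ (≤-trans (m≤m+n q r) (≤-reflexive (n≡⌈n+n/2⌉ (q + r)))) ⟩
      ⌈ (q + r) + (q + r) /2⌉ + ((q + r) + m * q)  ≡⟨ cong (⌈ (q + r) + (q + r) /2⌉ +_) F≡ ⟨
      _                                             ∎)
    (begin
      t                                             ≡⟨ t≡ m q r ⟩
      q + ((q + r) + m * q)                         ≡⟨ cong₂ _+_ (n≡⌈n+n/2⌉ q) (sym F≡) ⟩
      _                                             ∎)
  size-D : size D ≡ 2 * t ∸ 2 * q
  size-D = trans (size-spike {m} _ _) (trans (2k≡ m q r) (sym (2t∸2q≡2k (suc m) q r)))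
    where
    2k≡ : ∀ m q r → (q + r) + (q + r) + m * (q + q) ≡ (suc m * q + r) + (suc m * q + r)
    2k≡ = solve-∀
  lower : ∀ D′ → Solvable t D′ → 2 * t ∸ 2 * q ≤ size D′
  lower D′ solvable′ =
    subst (λ x → 2 * t ∸ 2 * q ∸ x ≤ size D′) (m≤n⇒m∸n≡0 r<n) (solvable⇒size≥ q r D′ solvable′)

optimal-at : ∀ {n t q r} .{{_ : NonZero n}} → t ≡ r + q * suc n → r ≡ n →
             IsOptPebblingKn n t (2 * t ∸ 2 * q ∸ 1)
optimal-at {suc m} {q = q} refl refl = (D , solvable , size-D) , lower
  where
  open ≡-Reasoning
  n = suc m
  t = n + q * suc n
  D = spike {m} (suc (q + q)) (suc (suc (q + q)))
  F≡ : ⌈ q + q /2⌉ + m * suc ⌊ q + q /2⌋ ≡ q + m * suc q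
  F≡ = cong₂ (λ x y → x + m * suc y) (sym (n≡⌈n+n/2⌉ q)) (sym (n≡⌊n+n/2⌋ q))
  t≡ : ∀ m q → suc m + q * suc (suc m) ≡ suc q + (q + m * suc q)
  t≡ = solve-∀
  solvable : Solvable t D
  solvable = spike-solvable _ _
    (≤-reflexive (begin
      t                                         ≡⟨ t≡ m q ⟩
      suc q + (q + m * suc q)                   ≡⟨ cong₂ (λ x y → suc x + y) (n≡⌊n+n/2⌋ q) (sym F≡) ⟩
      _                                         ∎))
    (≤-reflexive (begin
      t                                         ≡⟨ t≡ m q ⟩
      suc q + (q + m * suc q)                   ≡⟨ cong₂ (λ x y → suc x + y) (n≡⌈n+n/2⌉ q) (sym F≡) ⟩
      _                                         ∎))
  size-D : size D ≡ 2 * t ∸ 2 * q ∸ 1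
  size-D = begin
    size D                                      ≡⟨ size-spike {m} _ _ ⟩
    suc (q + q) + m * suc (suc (q + q))         ≡⟨⟩
    suc (suc (q + q) + m * suc (suc (q + q))) ∸ 1 ≡⟨ cong (_∸ 1) (2k≡ m q) ⟩
    (n * q + n) + (n * q + n) ∸ 1               ≡⟨ cong (_∸ 1) (2t∸2q≡2k n q n) ⟨
    2 * t ∸ 2 * q ∸ 1                           ∎
    where
    2k≡ : ∀ m q → suc (suc (q + q) + m * suc (suc (q + q))) ≡ (suc m * q + suc m) + (suc m * q + suc m)
    2k≡ = solve-∀
  lower : ∀ D′ → Solvable t D′ → 2 * t ∸ 2 * q ∸ 1 ≤ size D′
  lower D′ solvable′ =
    subst (λ x → 2 * t ∸ 2 * q ∸ x ≤ size D′) (m+n∸n≡m 1 m) (solvable⇒size≥ q n D′ solvable′)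

IsOptPebblingKn-unique : ∀ {n t a b} → IsOptPebblingKn n t a → IsOptPebblingKn n t b → a ≡ b
IsOptPebblingKn-unique ((Da , solvable-a , size-a) , a≤) ((Db , solvable-b , size-b) , b≤) =
  ≤-antisym (subst (_ ≤_) size-b (a≤ Db solvable-b)) (subst (_ ≤_) size-a (b≤ Da solvable-a))

m∸n≡m⇒n≡0 : ∀ {m n} → 0 < m → m ∸ n ≡ m → n ≡ 0
m∸n≡m⇒n≡0 {n = zero}      _ _  = refl
m∸n≡m⇒n≡0 {suc m} {suc n} _ eq = contradiction eq (<⇒≢ (s≤s (m∸n≤m m n)))

theorem3p3 : ∀ (n t : ℕ) → 1 ≤ n → 1 ≤ t →
    ((t % suc n < n → IsOptPebblingKn n t (2 * t ∸ 2 * (t / suc n))) ×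
     (t % suc n ≡ n → IsOptPebblingKn n t (2 * t ∸ 2 * (t / suc n) ∸ 1))) ×
    (IsOptPebblingKn n t (2 * t) ⇔ t < n)
theorem3p3 n@(suc _) t _ 1≤t = (optimal-below {q = q} t≡ , optimal-at {q = q} t≡) , mk⇔ only-if if
  where
  q = t / suc n
  r = t % suc n
  t≡ : t ≡ r + q * suc n
  t≡ = m≡m%n+[m/n]*n t (suc n)
  0<2t : 0 < 2 * t
  0<2t = ≤-trans 1≤t (m≤n*m t 2)
  only-if : IsOptPebblingKn n t (2 * t) → t < n
  only-if opt with m≤n⇒m<n∨m≡n (≤-pred (m%n<n t (suc n)))
  ... | inj₁ r<n = subst (_< n) (sym t≡r) r<n
    where
    q≡0 : q ≡ 0
    q≡0 = m*n≡0⇒m≡0 q 2 (trans (*-comm q 2) (m∸n≡m⇒n≡0 0<2t (IsOptPebblingKn-unique (optimal-below {q = q} t≡ r<n) opt)))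
    t≡r : t ≡ r
    t≡r = trans t≡ (trans (cong (λ y → r + y * suc n) q≡0) (+-identityʳ r))
  ... | inj₂ r≡n = contradiction
    (m∸n≡m⇒n≡0 0<2t (trans (sym (∸-+-assoc (2 * t) (2 * q) 1)) (IsOptPebblingKn-unique (optimal-at {q = q} t≡ r≡n) opt)))
    (m+1+n≢0 (2 * q))
  if : t < n → IsOptPebblingKn n t (2 * t)
  if t<n = subst (λ y → IsOptPebblingKn n t (2 * t ∸ 2 * y)) (m<n⇒m/n≡0 (m≤n⇒m≤1+n t<n))
                 (optimal-below {q = q} t≡ (subst (_< n) (sym (m<n⇒m%n≡m (m≤n⇒m≤1+n t<n))) t<n))
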